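{- Let $m, n \in \mathbb{N}$ with $n \le m$ and let $k \in \mathbb{N}^{n+1}$ be such that $P_{m,n}(k)$ holds. Let $l \in \mathbb{L}_{\ge m}$ be such that $\mathrm{mls}_n(l) = \mathrm{succ}(k)$ and $\mathrm{ml}_{n+1}(l) = 0$. Then $l \in \mathrm{ran}(\mathrm{lgen}_m)$.
   Context: Lists of natural numbers; $[\,]$, $h::t$ as usual. For $m \in \mathbb{N}$, $\mathrm{next}_m$ is defined by: $\mathrm{next}_m([\,]) = [0]$; $\mathrm{next}_m(h :: t) = (h+1) :: t$ if $h < m$; if $h \ge m$: $\mathrm{next}_m(h :: t) = [\,]$ when $\mathrm{next}_m(t) = [\,]$, and $=x :: x :: t'$ when $\mathrm{next}_m(t) = x :: t'$. $\mathrm{lgen}_m(0) = [\,]$, $\mathrm{lgen}_m(x+1) = \mathrm{next}_m(\mathrm{lgen}_m(x))$, and $\mathrm{ran}(\mathrm{lgen}_m)$ is its range. $\mathbb{L}_{\ge m}$ is the set of lists sorted in non-increasing order with all elements $\le m$. For a list $l$ and $i \in \mathbb{N}$, $\mathrm{ml}_i(l)$ is the number of elements of $l$ (with multiplicity) that are $\ge i$. $\mathrm{mls}_n(l) = (\mathrm{ml}_0(l), \dots, \mathrm{ml}_n(l))$. For $k \in \mathbb{N}^{n+1}$, $P_{m,n}(k)$ is the proposition: for every $l \in \mathbb{L}_{\ge m}$, if $\mathrm{mls}_n(l) = k$ then $l \in \mathrm{ran}(\mathrm{lgen}_m)$. For $k = (k_0,\dots,k_n)$, $\mathrm{succ}(k)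 = (k_0,\dots,k_{n-1},k_n+1)$. -}

module Defs where

open import Data.Nat using (ℕ; zero; suc; _≤_; _≥_; _<?_; _≤?_)
open import Data.List using (List; []; _∷_; length; filter)
open import Data.List.Relation.Unary.All using (All)
open import Data.List.Relation.Unary.Linked using (Linked)
open import Data.Vec using (Vec; tabulate; updateAt)
open import Data.Fin using (Fin; toℕ; fromℕ)
open import Data.Product using (∃; _×_)
open import Relation.Binary.PropositionalEquality using (_≡_)
open import Relation.Nullary.Decidable using (does)
open import Data.Bool using (if_then_else_)

next : ℕ → List ℕ → List ℕ
next m [] = 0 ∷ []
next m (h ∷ t) with does (h <? m)
... | Data.Bool.true = suc h ∷ t
... | Data.Bool.false with next m t
...   | [] = []
...   | x ∷ t' = x ∷ x ∷ t'

lgen : ℕ → ℕ → List ℕ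
lgen m zero = []
lgen m (suc x) = next m (lgen m x)

InRan : ℕ → List ℕ → Set
InRan m l = ∃ λ x → lgen m x ≡ l

L≥ : ℕ → List ℕ → Set
L≥ m l = Linked _≥_ l × All (_≤ m) l

ml : ℕ → List ℕ → ℕ
ml i l = length (filter (i ≤?_) l)

mls : (n : ℕ) → List ℕ → Vec ℕ (suc n)
mls n l = tabulate (λ (j : Fin (suc n)) → ml (toℕ j) l)

P : (m n : ℕ) → Vec ℕ (suc n) → Set
P m n k = ∀ (l : List ℕ) → L≥ m l → mls n l ≡ k → InRan m l

succV : {n : ℕ} → Vec ℕ (suc n) → Vec ℕ (suc n)
succV {n} k = updateAt k (fromℕ n) suc

-- Because ml_(n+1) l = 0 and ml_n l = k_n + 1, the sorted list l is a run of k_n + 1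
-- copies of n followed by a tail below n. Replacing that run by k_n copies of m
-- followed by n - 1 (by nothing when n = 0) gives a list p in L_(≥m) with next_m p = l:
-- next_m raises n - 1 to n and its carry clause turns the copies of m back into
-- copies of n. Counting shows mls_n p = k, so p is in the range of lgen_m by
-- P_(m,n)(k), and l is its successor.
module Submission where

open import Defs
open import Data.Nat using (ℕ; zero; suc; _+_; _≤_; _<_; _≥_; _≤?_; _<?_; s≤s⁻¹)
open import Data.Nat.Properties
  using ( ≤-refl; ≤-trans; <-irrefl; ≤-<-trans; <⇒≤; ≮⇒≥; ≰⇒>; <⇒≱; ≤-antisym
        ; +-suc; +-identityʳ; suc-injective)
open import Data.List using (List; []; _∷_; _++_; length; replicate)
open import Data.List.Properties using (filter-accept; filter-reject; filter-none)
open import Data.List.Relation.Unary.All as All using (All; []; _∷_)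
open import Data.List.Relation.Unary.All.Properties using (++⁺; replicate⁺)
open import Data.List.Relation.Unary.Linked as Linked using (Linked; []; [-]; _∷_)
open import Data.List.Relation.Unary.Linked.Properties using (Linked⇒All)
open import Data.Vec using (Vec; lookup)
open import Data.Vec.Properties
  using (lookup∘tabulate; lookup∘updateAt; lookup∘updateAt′; tabulate-cong; tabulate∘lookup)
open import Data.Fin using (toℕ; fromℕ; inject₁)
open import Data.Fin.Properties using (toℕ-fromℕ; toℕ-inject₁; toℕ<n; fromℕ≢inject₁)
open import Data.Fin.Relation.Unary.Top using (view; ‵fromℕ; ‵inject₁)
open import Data.Product using (_,_; ∃₂; _×_)
open import Function using (_∘_)
open import Relation.Binary.PropositionalEquality
open import Relation.Nullary using (¬_; yes; no)
open import Relation.Nullary.Decidable using (dec-true; dec-false)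

next-< : ∀ {m h t} → h < m → next m (h ∷ t) ≡ suc h ∷ t
next-< {m} {h} h<m rewrite dec-true (h <? m) h<m = refl

next-≮ : ∀ {m h t y u} → ¬ h < m → next m t ≡ y ∷ u → next m (h ∷ t) ≡ y ∷ y ∷ u
next-≮ {m} {h} h≮m eq rewrite dec-false (h <? m) h≮m | eq = refl

next-replicate-++ : ∀ {m ys y zs} r → next m ys ≡ y ∷ zs →
  next m (replicate r m ++ ys) ≡ replicate (suc r) y ++ zs
next-replicate-++          zero    eq = eq
next-replicate-++ {m} {ys} (suc r) eq =
  next-≮ {t = replicate r m ++ ys} (<-irrefl refl) (next-replicate-++ r eq)

next-InRan : ∀ {m l} → InRan m l → InRan m (next m l)
next-InRan (x , lgen≡l) = suc x , cong (next _) lgen≡l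

ml-accept : ∀ {i x} xs → i ≤ x → ml i (x ∷ xs) ≡ suc (ml i xs)
ml-accept {i} xs i≤x = cong length (filter-accept (i ≤?_) i≤x)

ml-reject : ∀ {i x} xs → x < i → ml i (x ∷ xs) ≡ ml i xs
ml-reject {i} xs x<i = cong length (filter-reject (i ≤?_) (<⇒≱ x<i))

ml-all-< : ∀ {i xs} → All (_< i) xs → ml i xs ≡ 0
ml-all-< {i} xs<i = cong length (filter-none (i ≤?_) (All.map <⇒≱ xs<i))

ml≡0⇒all-< : ∀ {i} xs → ml i xs ≡ 0 → All (_< i) xs
ml≡0⇒all-<     []       _  = []
ml≡0⇒all-< {i} (x ∷ xs) eq with i ≤? x
... | yes i≤x with () ← trans (sym (ml-accept xs i≤x)) eq
... | no  i≰x = x<i ∷ ml≡0⇒all-< xs (trans (sym (ml-reject xs x<i)) eq)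
  where
  x<i : x < i
  x<i = ≰⇒> i≰x

ml-replicate-++ : ∀ {i x} r ys → i ≤ x → ml i (replicate r x ++ ys) ≡ r + ml i ys
ml-replicate-++ zero    ys i≤x = refl
ml-replicate-++ (suc r) ys i≤x =
  trans (ml-accept (replicate r _ ++ ys) i≤x) (cong suc (ml-replicate-++ r ys i≤x))

ml-replicate-++-all-< : ∀ {i x ys} r → i ≤ x → All (_< i) ys → ml i (replicate r x ++ ys) ≡ r
ml-replicate-++-all-< {ys = ys} r i≤x ys<i = begin
  ml _ (replicate r _ ++ ys)  ≡⟨ ml-replicate-++ r ys i≤x ⟩
  r + ml _ ys                 ≡⟨ cong (r +_) (ml-all-< ys<i) ⟩
  r + 0                       ≡⟨ +-identityʳ r ⟩
  r                           ∎
  where open ≡-Reasoning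

mls-lookup : ∀ {n l v} → mls n l ≡ v → ∀ j → ml (toℕ j) l ≡ lookup v j
mls-lookup {l = l} refl j = sym (lookup∘tabulate (λ i → ml (toℕ i) l) j)

mls-succV-last : ∀ {n l k} → mls n l ≡ succV k → ml n l ≡ suc (lookup k (fromℕ n))
mls-succV-last {n} {l} {k} eq = subst (λ i → ml i l ≡ suc (lookup k (fromℕ n))) (toℕ-fromℕ n)
  (trans (mls-lookup {l = l} eq (fromℕ n)) (lookup∘updateAt (fromℕ n) k))

mls-unsucc : ∀ {n l p k} → mls n l ≡ succV k →
  (∀ {i} → i < n → ml i p ≡ ml i l) → suc (ml n p) ≡ ml n l → mls n p ≡ k
mls-unsucc {n} {l} {p} {k} eq below last =
  trans (tabulate-cong agree) (tabulate∘lookup k)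
  where
  open ≡-Reasoning
  agree : ∀ j → ml (toℕ j) p ≡ lookup k j
  agree j with view j
  ... | ‵fromℕ rewrite toℕ-fromℕ n = suc-injective (trans last (mls-succV-last {l = l} eq))
  ... | ‵inject₁ i = begin
    ml (toℕ (inject₁ i)) p       ≡⟨ below (subst (_< n) (sym (toℕ-inject₁ i)) (toℕ<n i)) ⟩
    ml (toℕ (inject₁ i)) l       ≡⟨ mls-lookup {l = l} eq (inject₁ i) ⟩
    lookup (succV k) (inject₁ i) ≡⟨ lookup∘updateAt′ (inject₁ i) (fromℕ n) (fromℕ≢inject₁ ∘ sym) k ⟩
    lookup k (inject₁ i)         ∎

∷-sorted : ∀ {x xs} → All (_≤ x) xs → Linked _≥_ xs → Linked _≥_ (x ∷ xs)
∷-sorted []        []     = [-]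
∷-sorted (y≤x ∷ _) sorted = y≤x ∷ sorted

replicate-++-sorted : ∀ {x ys} r → All (_≤ x) ys → Linked _≥_ ys → Linked _≥_ (replicate r x ++ ys)
replicate-++-sorted zero    ys≤x sorted = sorted
replicate-++-sorted (suc r) ys≤x sorted =
  ∷-sorted (++⁺ (replicate⁺ r ≤-refl) ys≤x) (replicate-++-sorted r ys≤x sorted)

sorted-head-< : ∀ {n h t} → Linked _≥_ (h ∷ t) → h < n → All (_< n) (h ∷ t)
sorted-head-< sorted h<n =
  All.map (λ y≤h → ≤-<-trans y≤h h<n) (Linked⇒All (λ y≤x z≤y → ≤-trans z≤y y≤x) ≤-refl sorted)

sorted-split : ∀ n {l} → Linked _≥_ l → All (_≤ n) l →
  ∃₂ λ r rest → l ≡ replicate r n ++ rest × Linked _≥_ rest × All (_< n) rest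
sorted-split n []     []        = 0 , [] , refl , [] , []
sorted-split n {h ∷ t} sorted (h≤n ∷ t≤n) with h <? n
... | yes h<n = 0 , h ∷ t , refl , sorted , sorted-head-< sorted h<n
... | no  h≮n with refl ← ≤-antisym h≤n (≮⇒≥ h≮n)
                with r , rest , refl , rest-sorted , rest<n ← sorted-split n (Linked.tail sorted) t≤n
                = suc r , rest , refl , rest-sorted , rest<n

-- The n = 0 clause is only used with an empty tail, where next m [] = 0 ∷ [].
prevHead : ℕ → List ℕ → List ℕ
prevHead zero    _    = []
prevHead (suc n) rest = n ∷ rest

next-prevHead : ∀ {m n rest} → n ≤ m → All (_< n) rest → next m (prevHead n rest) ≡ n ∷ rest
next-prevHead {n = zero}  _   [] = refl
next-prevHead {n = suc n} n<m _  = next-< n<m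

prevHead-all-< : ∀ {n rest} → All (_< n) rest → All (_< n) (prevHead n rest)
prevHead-all-< {zero}  _      = []
prevHead-all-< {suc n} rest<n = ≤-refl ∷ rest<n

prevHead-sorted : ∀ {n rest} → Linked _≥_ rest → All (_< n) rest → Linked _≥_ (prevHead n rest)
prevHead-sorted {zero}  _      _      = []
prevHead-sorted {suc n} sorted rest<n = ∷-sorted (All.map s≤s⁻¹ rest<n) sorted

ml-prevHead : ∀ {i n} rest → i < n → ml i (prevHead n rest) ≡ suc (ml i rest)
ml-prevHead {n = suc n} rest i<n = ml-accept rest (s≤s⁻¹ i<n)

predecessor : (m n r : ℕ) → List ℕ → List ℕ
predecessor m n r rest = replicate r m ++ prevHead n rest

predecessor-L≥ : ∀ {m n rest} r → n ≤ m → Linked _≥_ rest → All (_< n) rest →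
  L≥ m (predecessor m n r rest)
predecessor-L≥ {m} {n} {rest} r n≤m rest-sorted rest<n =
  replicate-++-sorted r tail≤m (prevHead-sorted rest-sorted rest<n) ,
  ++⁺ (replicate⁺ r ≤-refl) tail≤m
  where
  tail≤m : All (_≤ m) (prevHead n rest)
  tail≤m = All.map (λ x<n → ≤-trans (<⇒≤ x<n) n≤m) (prevHead-all-< rest<n)

next-predecessor : ∀ {m n rest} r → n ≤ m → All (_< n) rest →
  next m (predecessor m n r rest) ≡ replicate (suc r) n ++ rest
next-predecessor r n≤m rest<n = next-replicate-++ r (next-prevHead n≤m rest<n)

ml-predecessor-< : ∀ {m n i} r rest → n ≤ m → i < n →
  ml i (predecessor m n r rest) ≡ ml i (replicate (suc r) n ++ rest)
ml-predecessor-< {m} {n} {i} r rest n≤m i<n = begin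
  ml i (replicate r m ++ prevHead n rest)  ≡⟨ ml-replicate-++ r _ (≤-trans (<⇒≤ i<n) n≤m) ⟩
  r + ml i (prevHead n rest)               ≡⟨ cong (r +_) (ml-prevHead rest i<n) ⟩
  r + suc (ml i rest)                      ≡⟨ +-suc r _ ⟩
  suc (r + ml i rest)                      ≡⟨ sym (ml-replicate-++ (suc r) rest (<⇒≤ i<n)) ⟩
  ml i (replicate (suc r) n ++ rest)       ∎
  where open ≡-Reasoning

ml-predecessor-last : ∀ {m n rest} r → n ≤ m → All (_< n) rest →
  suc (ml n (predecessor m n r rest)) ≡ ml n (replicate (suc r) n ++ rest)
ml-predecessor-last r n≤m rest<n =
  trans (cong suc (ml-replicate-++-all-< r n≤m (prevHead-all-< rest<n)))
        (sym (ml-replicate-++-all-< (suc r) ≤-refl rest<n))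

lemma4 : (m n : ℕ) → n ≤ m → (k : Vec ℕ (suc n)) → P m n k →
    (l : List ℕ) → L≥ m l → mls n l ≡ succV k → ml (suc n) l ≡ 0 →
    InRan m l
lemma4 m n n≤m k Pk l (l-sorted , _) mls≡ ml≡0
  with r , rest , refl , rest-sorted , rest<n
         ← sorted-split n l-sorted (All.map s≤s⁻¹ (ml≡0⇒all-< l ml≡0))
  with refl ← trans (sym (ml-replicate-++-all-< r ≤-refl rest<n)) (mls-succV-last {l = l} mls≡)
  = subst (InRan m) (next-predecessor r₀ n≤m rest<n) (next-InRan p∈ran)
  where
  r₀ : ℕ
  r₀ = lookup k (fromℕ n)
  p : List ℕ
  p = predecessor m n r₀ rest
  p∈ran : InRan m p
  p∈ran = Pk p (predecessor-L≥ r₀ n≤m rest-sorted rest<n)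
    (mls-unsucc {p = p} mls≡ (ml-predecessor-< r₀ rest n≤m) (ml-predecessor-last r₀ n≤m rest<n))
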